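{- Let $a$ be a positive integer, $n=a^2+1$, and let $A\subseteq\mathbb{Z}_n$ be an $a$-subset with $A=-A$ that is a union of sets $P_x$, where $0\notin A$ if $a$ is even, and $0\in A$, $(a^2+1)/2\notin A$ if $a$ is odd. Let $U=(u[P_y])$ be a $(0,1)$-valued vector indexed by $\mathcal{P}\setminus\mathcal{P}(A)$ and let $J$ be the all-ones vector indexed by $\mathcal{P}$. Then $U$ is a solution of the matrix equation $M_AU^T=J^T$ if and only if \[B=\bigcup\{P_y\in\mathcal{P}\setminus\mathcal{P}(A): u[P_y]=1\}\] is a mate to $A$.
   Context: For $x\in\mathbb{Z}_n$, $P_x=\{x,-x\}$ (sets $P_x$ are considered as sets, so $P_x=P_{ -x}$). If $a$ is even, $\mathcal{P}=\{P_x: 1\le x\le a^2/2\}$; if $a$ is odd, $\mathcal{P}=\{P_x:1\le x\le (a^2+1)/2\}$. $\mathcal{P}(A)=\{P_x: P_x\subseteq A\}$. For subsets $S,T$ of $\mathbb{Z}_n$, $\mathcal{D}(T,S)$ is the multiset $\{t-s: t\in T, s\in S\}$. For $P_y\in\mathcal{P}\setminus\mathcal{P}(A)$ and $P_d\in\mathcal{P}$, $M_A[P_d,P_y]$ is the number of distinct sets $P_x$ with $P_x\subseteq A$ and $P_d\subseteq\mathcal{D}(P_y,P_x)$; this defines the $|\mathcal{P}|\times|\mathcal{P}\setminus\mathcal{P}(A)|$ matrix $M_A$. An $a$-subset $A$ of $\mathbb{Z}_n$ has a mate $B$ if $B$ is an $a$-subset of $\mathbb{Z}_n$ such that the multiset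 $\mathcal{D}(B,A)$ equals $\mathbb{Z}_n\setminus\{0\}$ (each nonzero element exactly once). -}

module Defs where

open import Data.Nat using (ℕ; zero; suc; _+_; _*_; _∸_; _≡ᵇ_; _≤ᵇ_)
open import Data.Nat.DivMod using (_mod_; _/_)
open import Data.Nat.Divisibility using (_∣?_)
open import Data.Fin using (Fin; toℕ; zero)
open import Data.Fin.Subset using (Subset; ∣_∣)
open import Data.Bool using (Bool; true; false; _∧_; _∨_; not; T; if_then_else_)
open import Data.Product using (Σ; _,_; _×_)
open import Data.Unit using (tt)
import Data.Vec as V
open import Data.List using (tabulate)
open import Data.Nat.ListAction using (sum)
open import Data.Bool.ListAction using (or)
open import Relation.Nullary using (does)
open import Relation.Binary.PropositionalEquality using (_≡_)

N : ℕ → ℕ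
N a = suc (a * a)

Zn : ℕ → Set
Zn a = Fin (N a)

ι : (a : ℕ) → ℕ → Zn a
ι a k = k mod N a

neg : (a : ℕ) → Zn a → Zn a
neg a x = ι a (N a ∸ toℕ x)

sub : (a : ℕ) → Zn a → Zn a → Zn a
sub a x y = ι a (toℕ x + (N a ∸ toℕ y))

eqF : ∀ {m} → Fin m → Fin m → Bool
eqF x y = toℕ x ≡ᵇ toℕ y

-- number of elements of 𝒫: a²/2 if a even, (a²+1)/2 if a odd
h : ℕ → ℕ
h a = if does (2 ∣? a) then (a * a) / 2 else (a * a + 1) / 2

-- the element x (with 1 ≤ x ≤ h a) representing the i-th member P_x of 𝒫
rep : (a : ℕ) → Fin (h a) → Zn a
rep a i = ι a (suc (toℕ i))

inP : (a : ℕ) → Zn a → Zn a → Bool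
inP a x z = eqF z x ∨ eqF z (neg a x)

subP : (a : ℕ) → Subset (N a) → Zn a → Bool
subP a A x = V.lookup A x ∧ V.lookup A (neg a x)

inD : (a : ℕ) → Zn a → Zn a → Zn a → Bool
inD a v y x =
  eqF (sub a y x) v ∨ eqF (sub a y (neg a x)) v ∨
  eqF (sub a (neg a y) x) v ∨ eqF (sub a (neg a y) (neg a x)) v

PsubD : (a : ℕ) → Zn a → Zn a → Zn a → Bool
PsubD a d y x = inD a d y x ∧ inD a (neg a d) y x

count : (k : ℕ) → (Fin k → Bool) → ℕ
count k f = sum (tabulate {n = k} (λ i → if f i then 1 else 0))

-- M_A[P_d, P_y]: number of distinct sets P_x (x ∈ Z_n) with P_x ⊆ A and
-- P_d ⊆ 𝒟(P_y, P_x); each set P_x = {x, -x} is counted once, via its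
-- representative x with x ≤ -x (as natural numbers in 0..n-1).
M : (a : ℕ) → Subset (N a) → Fin (h a) → Fin (h a) → ℕ
M a A d y = count (N a) (λ x →
  (toℕ x ≤ᵇ toℕ (neg a x)) ∧ subP a A x ∧ PsubD a (rep a d) (rep a y) x)

Idx : (a : ℕ) → Subset (N a) → Set
Idx a A = Σ (Fin (h a)) (λ i → T (not (subP a A (rep a i))))

restrictℕ : (b : Bool) → (T b → ℕ) → ℕ
restrictℕ true f = f tt
restrictℕ false f = 0

restrictB : (b : Bool) → (T b → Bool) → Bool
restrictB true f = f tt
restrictB false f = false

Vec01 : (a : ℕ) → Subset (N a) → Set
Vec01 a A = Idx a A → Bool

b2n : Bool → ℕ
b2n true = 1
b2n false = 0

MU : (a : ℕ) → (A : Subset (N a)) → Vec01 a A → Fin (h a) → ℕ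
MU a A U d = sum (tabulate {n = h a} (λ i →
  restrictℕ (not (subP a A (rep a i))) (λ p → M a A d i * b2n (U (i , p)))))

SolvesMatEq : (a : ℕ) → (A : Subset (N a)) → Vec01 a A → Set
SolvesMatEq a A U = ∀ (d : Fin (h a)) → MU a A U d ≡ 1

Bset : (a : ℕ) → (A : Subset (N a)) → Vec01 a A → Subset (N a)
Bset a A U = V.tabulate (λ z → or (tabulate {n = h a} (λ i →
  restrictB (not (subP a A (rep a i))) (λ p → U (i , p) ∧ inP a (rep a i) z))))

Dmult : (a : ℕ) → Subset (N a) → Subset (N a) → Zn a → ℕ
Dmult a T S z = sum (tabulate {n = N a} (λ t → count (N a) (λ s →
  V.lookup T t ∧ V.lookup S s ∧ eqF (sub a t s) z)))

IsMate : (a : ℕ) → Subset (N a) → Subset (N a) → Set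
IsMate a A B = ∣ B ∣ ≡ a ×
  (∀ (z : Zn a) → Dmult a B A z ≡ (if eqF z (zero {n = a * a}) then 0 else 1))

{-# OPTIONS --safe #-}
-- Write mult z for the multiplicity of z in D(B, A). For z ∈ P_d, the map
-- (t, s) ↦ (P_t, P_s) sends the pairs t ∈ B, s ∈ A with t - s = z onto the
-- pairs (P_y, P_x) counted by (M_A U^T)[P_d], injectively unless z = -z.
-- So if B is a mate, every entry of M_A U^T is 1. Conversely, if M_A U^T = J^T
-- then mult 0 = 0 (a chosen P_y is not contained in A = -A), and mult z = 1
-- whenever 0 ≠ z ≠ -z. At most one nonzero w satisfies w = -w, and for it
-- 1 ≤ mult w ≤ |A| = a; summing, a|B| = Σ mult = a² - 1 + mult w forces
-- mult w = 1. Hence Σ mult = a² and |B| = a.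
module Submission where

open import Defs
open import Level using (0ℓ)
open import Data.Nat
  using (ℕ; zero; suc; _+_; _*_; _∸_; _⊓_; _≤_; _<_; _≤ᵇ_; z≤n; s≤s; z<s; NonZero; >-nonZero; >-nonZero⁻¹; ⌊_/2⌋)
open import Data.Nat.Properties
open import Data.Nat.DivMod
open import Data.Nat.Divisibility using (_∣_; _∣?_; ∣m⇒∣m*n)
open import Data.Nat.Tactic.RingSolver using (solve-∀)
open import Algebra.Properties.CommutativeSemigroup +-commutativeSemigroup using (interchange; xy∙z≈zy∙x)
open import Algebra.Properties.CommutativeMonoid.Sum +-0-commutativeMonoid
  using (sum; sum-cong-≗; sum-replicate-zero; ∑-comm)
open import Algebra.Properties.Semiring.Sum +-*-semiring using (*-distribˡ-sum; *-distribʳ-sum)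
open import Data.Fin using (Fin; toℕ; fromℕ<; zero; suc)
import Data.Fin.Properties as Fin
open import Data.Fin.Subset using (Subset; _∈_; _∉_; ∣_∣)
open import Data.Bool using (Bool; true; false; T; not; _∧_; _∨_; if_then_else_)
open import Data.Bool.Properties using (T-∧; T-∨; T-≡; T-not-≡)
open import Data.Bool.ListAction using (or)
open import Data.Product using (Σ; _×_; _,_; proj₁; proj₂; ∃; ∃₂)
open import Data.Product.Function.NonDependent.Propositional using (_×-⇔_)
open import Data.Sum using (_⊎_; inj₁; inj₂)
open import Data.Sum.Function.Propositional using (_⊎-⇔_)
open import Data.Unit using (tt)
import Data.List as List
import Data.Nat.ListAction as ListAction
import Data.Vec as Vec
import Data.Vec.Properties as Vec
open import Function using (_∘_; _⇔_; mk⇔; Equivalence)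
open import Function.Construct.Composition using (_⇔-∘_)
open import Function.Construct.Identity using (⇔-id)
open import Relation.Binary using (Setoid)
import Relation.Binary.Reasoning.Setoid
open import Relation.Binary.PropositionalEquality
open import Relation.Nullary using (¬_; contradiction; Dec; yes; no; does)

-- Finite sums

sum-tabulate : ∀ {k} (g : Fin k → ℕ) → ListAction.sum (List.tabulate g) ≡ sum g
sum-tabulate {zero} g = refl
sum-tabulate {suc k} g = cong (g zero +_) (sum-tabulate (g ∘ suc))

sum-ones : ∀ k → sum {k} (λ _ → 1) ≡ k
sum-ones zero = refl
sum-ones (suc k) = cong suc (sum-ones k)

≤-sum : ∀ {k} (g : Fin k → ℕ) i → g i ≤ sum g
≤-sum g zero = m≤m+n (g zero) _
≤-sum g (suc i) = ≤-trans (≤-sum (g ∘ suc) i) (m≤n+m _ (g zero))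

sum-mono-≤ : ∀ {k} {f g : Fin k → ℕ} → (∀ i → f i ≤ g i) → sum f ≤ sum g
sum-mono-≤ {zero} _ = z≤n
sum-mono-≤ {suc k} f≤g = +-mono-≤ (f≤g zero) (sum-mono-≤ (f≤g ∘ suc))

sum-pos⇒∃ : ∀ {k} (g : Fin k → ℕ) → 0 < sum g → ∃ λ i → 0 < g i
sum-pos⇒∃ {suc k} g pos with g zero in eq
... | suc _ = zero , subst (0 <_) (sym eq) (s≤s z≤n)
... | zero = let i , p = sum-pos⇒∃ (g ∘ suc) pos in suc i , p

sum≤1⇒pos-unique : ∀ {k} (g : Fin k → ℕ) → sum g ≤ 1 → ∀ {i j} → 0 < g i → 0 < g j → i ≡ j
sum≤1⇒pos-unique g ≤1 {zero} {zero} _ _ = refl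
sum≤1⇒pos-unique g ≤1 {zero} {suc j} p q =
  contradiction (≤-trans (+-mono-≤ p (≤-trans q (≤-sum (g ∘ suc) j))) ≤1) 1+n≰n
sum≤1⇒pos-unique g ≤1 {suc i} {zero} p q = sym (sum≤1⇒pos-unique g ≤1 q p)
sum≤1⇒pos-unique g ≤1 {suc i} {suc j} p q =
  cong suc (sum≤1⇒pos-unique (g ∘ suc) (m+n≤o⇒n≤o (g zero) ≤1) p q)

pos-unique⇒sum≤1 : ∀ {k} (g : Fin k → ℕ) → (∀ i → g i ≤ 1) →
                    (∀ {i j} → 0 < g i → 0 < g j → i ≡ j) → sum g ≤ 1
pos-unique⇒sum≤1 {zero} g _ _ = z≤n
pos-unique⇒sum≤1 {suc k} g bounded unique with g zero in eq
... | zero = pos-unique⇒sum≤1 (g ∘ suc) (bounded ∘ suc) (λ p q → Fin.suc-injective (unique p q))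
... | suc m = begin
  suc m + sum (g ∘ suc) ≡⟨ cong (suc m +_) rest≡0 ⟩
  suc m + 0             ≡⟨ trans (+-identityʳ _) (sym eq) ⟩
  g zero                ≤⟨ bounded zero ⟩
  1                     ∎
  where
  open ≤-Reasoning
  g0>0 : 0 < g zero
  g0>0 = subst (0 <_) (sym eq) (s≤s z≤n)
  rest-zero : ∀ j → g (suc j) ≡ 0
  rest-zero j = n≤0⇒n≡0 (≮⇒≥ λ pos → Fin.0≢1+n (unique g0>0 pos))
  rest≡0 : sum (g ∘ suc) ≡ 0
  rest≡0 = trans (sum-cong-≗ rest-zero) (sum-replicate-zero k)

sum-agree-except : ∀ {k} (f g : Fin k → ℕ) w → (∀ z → z ≢ w → f z ≡ g z) →
                   sum f + g w ≡ sum g + f w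
sum-agree-except {suc k} f g zero agree = begin
  f zero + sum (f ∘ suc) + g zero ≡⟨ cong (λ s → f zero + s + g zero) rest ⟩
  f zero + sum (g ∘ suc) + g zero ≡⟨ xy∙z≈zy∙x (f zero) _ _ ⟩
  g zero + sum (g ∘ suc) + f zero ∎
  where
  open ≡-Reasoning
  rest : sum (f ∘ suc) ≡ sum (g ∘ suc)
  rest = sum-cong-≗ λ z → agree (suc z) λ ()
sum-agree-except {suc k} f g (suc w) agree = begin
  f zero + sum (f ∘ suc) + g (suc w)   ≡⟨ +-assoc (f zero) _ _ ⟩
  f zero + (sum (f ∘ suc) + g (suc w)) ≡⟨ cong₂ _+_ (agree zero λ ()) rest ⟩
  g zero + (sum (g ∘ suc) + f (suc w)) ≡⟨ +-assoc (g zero) _ _ ⟨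
  g zero + sum (g ∘ suc) + f (suc w)   ∎
  where
  open ≡-Reasoning
  rest : sum (f ∘ suc) + g (suc w) ≡ sum (g ∘ suc) + f (suc w)
  rest = sum-agree-except (f ∘ suc) (g ∘ suc) w λ z z≢w → agree (suc z) (z≢w ∘ Fin.suc-injective)

-- Counting with Boolean predicates

b2n≤1 : ∀ b → b2n b ≤ 1
b2n≤1 true = ≤-refl
b2n≤1 false = z≤n

0<b2n⇔T : ∀ {b} → 0 < b2n b ⇔ T b
0<b2n⇔T {true} = mk⇔ _ (λ _ → ≤-refl)
0<b2n⇔T {false} = mk⇔ (λ ()) (λ ())

count≡sum : ∀ k (f : Fin k → Bool) → count k f ≡ sum (b2n ∘ f)
count≡sum k f = trans (sum-tabulate (λ i → if f i then 1 else 0)) (sum-cong-≗ (if≡b2n ∘ f))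
  where
  if≡b2n : ∀ b → (if b then 1 else 0) ≡ b2n b
  if≡b2n true = refl
  if≡b2n false = refl

unique⇒sum-b2n≤1 : ∀ {k} (f : Fin k → Bool) → (∀ {i j} → T (f i) → T (f j) → i ≡ j) →
                   sum (b2n ∘ f) ≤ 1
unique⇒sum-b2n≤1 f unique = pos-unique⇒sum≤1 (b2n ∘ f) (b2n≤1 ∘ f) λ p q →
  unique (Equivalence.to 0<b2n⇔T p) (Equivalence.to 0<b2n⇔T q)

sum-b2n-∧ : ∀ {k} b (f : Fin k → Bool) → sum (λ i → b2n (b ∧ f i)) ≡ b2n b * sum (b2n ∘ f)
sum-b2n-∧ true f = sym (*-identityˡ _)
sum-b2n-∧ {k} false f = sum-replicate-zero k

count₂ : ∀ {k m} → (Fin k → Fin m → Bool) → ℕ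
count₂ P = sum λ i → sum λ j → b2n (P i j)

module _ {k m} {P : Fin k → Fin m → Bool} {W : Fin k → Fin m → Set}
         (reflects : ∀ i j → T (P i j) ⇔ W i j) where

  private
    row : Fin k → ℕ
    row i = sum (b2n ∘ P i)

    entry-pos : ∀ {i j} → W i j → 0 < b2n (P i j)
    entry-pos {i} {j} w = Equivalence.from 0<b2n⇔T (Equivalence.from (reflects i j) w)

    row-pos : ∀ {i j} → W i j → 0 < row i
    row-pos {i} {j} w = <-≤-trans (entry-pos w) (≤-sum (b2n ∘ P i) j)

    row-witness : ∀ {i} → 0 < row i → ∃ (W i)
    row-witness {i} pos =
      let j , p = sum-pos⇒∃ (b2n ∘ P i) pos in j , Equivalence.to (reflects i j) (Equivalence.to 0<b2n⇔T p)

  count₂-pos⇔ : 0 < count₂ P ⇔ ∃₂ W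
  count₂-pos⇔ = mk⇔
    (λ pos → let i , p = sum-pos⇒∃ row pos in i , row-witness p)
    (λ (i , _ , w) → <-≤-trans (row-pos w) (≤-sum row i))

  count₂≤1⇔ : count₂ P ≤ 1 ⇔ (∀ {i j i′ j′} → W i j → W i′ j′ → i ≡ i′ × j ≡ j′)
  count₂≤1⇔ = mk⇔ unique (λ unique → pos-unique⇒sum≤1 row (row≤1 unique) λ p q →
    proj₁ (unique (proj₂ (row-witness p)) (proj₂ (row-witness q))))
    where
    unique : count₂ P ≤ 1 → ∀ {i j i′ j′} → W i j → W i′ j′ → i ≡ i′ × j ≡ j′
    unique ≤1 {i} w w′ with sum≤1⇒pos-unique row ≤1 (row-pos w) (row-pos w′)
    ... | refl = refl , sum≤1⇒pos-unique (b2n ∘ P i) (≤-trans (≤-sum row i) ≤1) (entry-pos w) (entry-pos w′)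
    row≤1 : (∀ {i j i′ j′} → W i j → W i′ j′ → i ≡ i′ × j ≡ j′) → ∀ i → row i ≤ 1
    row≤1 unique i = unique⇒sum-b2n≤1 (P i) λ {j} {j′} p q →
      proj₂ (unique (Equivalence.to (reflects i j) p) (Equivalence.to (reflects i j′) q))

T-∧⇔ : ∀ {x y} {P Q : Set} → T x ⇔ P → T y ⇔ Q → T (x ∧ y) ⇔ (P × Q)
T-∧⇔ x⇔P y⇔Q = (x⇔P ×-⇔ y⇔Q) ⇔-∘ T-∧

T-∨⇔ : ∀ {x y} {P Q : Set} → T x ⇔ P → T y ⇔ Q → T (x ∨ y) ⇔ (P ⊎ Q)
T-∨⇔ x⇔P y⇔Q = (x⇔P ⊎-⇔ y⇔Q) ⇔-∘ T-∨

T-eqF : ∀ {m} {x y : Fin m} → T (eqF x y) ⇔ x ≡ y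
T-eqF {x = x} {y} = mk⇔ (Fin.toℕ-injective ∘ ≡ᵇ⇒≡ (toℕ x) (toℕ y)) (≡⇒≡ᵇ (toℕ x) (toℕ y) ∘ cong toℕ)

T-≤ᵇ : ∀ {m n} → T (m ≤ᵇ n) ⇔ m ≤ n
T-≤ᵇ {m} {n} = mk⇔ (≤ᵇ⇒≤ m n) ≤⇒≤ᵇ

sum-b2n-eqF : ∀ {k} (w : Fin k) → sum (λ z → b2n (eqF w z)) ≡ 1
sum-b2n-eqF w = ≤-antisym
  (unique⇒sum-b2n≤1 (eqF w) λ p q → trans (sym (Equivalence.to w≡ p)) (Equivalence.to w≡ q))
  (≤-trans (Equivalence.from 0<b2n⇔T (Equivalence.from w≡ refl)) (≤-sum (λ z → b2n (eqF w z)) w))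
  where
  w≡ : ∀ {z} → T (eqF w z) ⇔ w ≡ z
  w≡ = T-eqF

T-or-tabulate : ∀ {k} (f : Fin k → Bool) → T (or (List.tabulate f)) ⇔ ∃ λ i → T (f i)
T-or-tabulate {zero} f = mk⇔ (λ ()) (λ ())
T-or-tabulate {suc k} f = mk⇔
  (λ p → case-∨ (Equivalence.to T-∨ p))
  (λ { (zero , t) → Equivalence.from T-∨ (inj₁ t)
     ; (suc i , t) → Equivalence.from T-∨ (inj₂ (Equivalence.from (T-or-tabulate (f ∘ suc)) (i , t))) })
  where
  case-∨ : T (f zero) ⊎ T (or (List.tabulate (f ∘ suc))) → ∃ λ i → T (f i)
  case-∨ (inj₁ t) = zero , t
  case-∨ (inj₂ t) = let i , t′ = Equivalence.to (T-or-tabulate (f ∘ suc)) t in suc i , t′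

T-restrictB : ∀ {b} (u : T b → Bool) → T (restrictB b u) → T b
T-restrictB {true} u _ = tt

T-restrictB-∧ : ∀ {b} (u : T b → Bool) c → T (restrictB b (λ p → u p ∧ c)) ⇔ (T (restrictB b u) × T c)
T-restrictB-∧ {true} u c = T-∧
T-restrictB-∧ {false} u c = mk⇔ (λ ()) (λ ())

restrictℕ-count : ∀ {k} b (u : T b → Bool) (f : Fin k → Bool) →
                  restrictℕ b (λ p → count k f * b2n (u p)) ≡ sum (λ j → b2n (restrictB b u ∧ f j))
restrictℕ-count {k} true u f with u tt
... | true = trans (*-identityʳ (count k f)) (count≡sum k f)
... | false = trans (*-zeroʳ (count k f)) (sym (sum-replicate-zero k))
restrictℕ-count {k} false u f = sym (sum-replicate-zero k)

_∈ᵇ_ : ∀ {k} → Fin k → Subset k → Set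
x ∈ᵇ p = T (Vec.lookup p x)

∈ᵇ⇔∈ : ∀ {k} {p : Subset k} {x} → x ∈ᵇ p ⇔ x ∈ p
∈ᵇ⇔∈ {p = p} {x} = mk⇔ (Vec.lookup⇒[]= x p ∘ Equivalence.to T-≡) (Equivalence.from T-≡ ∘ Vec.[]=⇒lookup)

∣∣≡sum : ∀ {k} (p : Subset k) → ∣ p ∣ ≡ sum (b2n ∘ Vec.lookup p)
∣∣≡sum Vec.[] = refl
∣∣≡sum (true Vec.∷ p) = cong suc (∣∣≡sum p)
∣∣≡sum (false Vec.∷ p) = ∣∣≡sum p

-- Arithmetic in Z_n

module Congruence (n : ℕ) .{{_ : NonZero n}} where

  infix 4 _≋_
  record _≋_ (m k : ℕ) : Set where
    constructor mk≋
    field %-≡ : m % n ≡ k % n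

  ≋-setoid : Setoid 0ℓ 0ℓ
  ≋-setoid = record
    { Carrier = ℕ
    ; _≈_ = _≋_
    ; isEquivalence = record
      { refl = mk≋ refl
      ; sym = λ (mk≋ p) → mk≋ (sym p)
      ; trans = λ (mk≋ p) (mk≋ q) → mk≋ (trans p q)
      }
    }

  open Setoid ≋-setoid public using () renaming (refl to ≋-refl; trans to ≋-trans)
  module ≋-Reasoning = Relation.Binary.Reasoning.Setoid ≋-setoid

  ≡⇒≋ : ∀ {m k} → m ≡ k → m ≋ k
  ≡⇒≋ refl = ≋-refl

  +-cong-≋ : ∀ {m m′ k k′} → m ≋ m′ → k ≋ k′ → m + k ≋ m′ + k′
  +-cong-≋ {m} {m′} {k} {k′} (mk≋ p) (mk≋ q) = mk≋ (begin
    (m + k) % n             ≡⟨ %-distribˡ-+ m k n ⟩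
    (m % n + k % n) % n     ≡⟨ cong₂ (λ u v → (u + v) % n) p q ⟩
    (m′ % n + k′ % n) % n   ≡⟨ %-distribˡ-+ m′ k′ n ⟨
    (m′ + k′) % n           ∎)
    where open ≡-Reasoning

  %-≋ : ∀ m → m % n ≋ m
  %-≋ m = mk≋ (m%n%n≡m%n m n)

  n≋0 : n ≋ 0
  n≋0 = mk≋ (trans (n%n≡0 n) (sym (m<n⇒m%n≡m (>-nonZero⁻¹ n))))

  +-cancelʳ-≋ : ∀ {m k} r → m + r ≋ k + r → m ≋ k
  +-cancelʳ-≋ {m} {k} r m+r≋k+r = begin
    m                     ≡⟨ +-identityʳ m ⟨
    m + 0                 ≈⟨ +-cong-≋ (≋-refl {m}) r+r′≋0 ⟨
    m + (r + r′)          ≡⟨ +-assoc m r r′ ⟨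
    m + r + r′            ≈⟨ +-cong-≋ m+r≋k+r ≋-refl ⟩
    k + r + r′            ≡⟨ +-assoc k r r′ ⟩
    k + (r + r′)          ≈⟨ +-cong-≋ (≋-refl {k}) r+r′≋0 ⟩
    k + 0                 ≡⟨ +-identityʳ k ⟩
    k                     ∎
    where
    open ≋-Reasoning
    r′ : ℕ
    r′ = n ∸ r % n
    r+r′≋0 : r + r′ ≋ 0
    r+r′≋0 = begin
      r + r′        ≈⟨ +-cong-≋ (%-≋ r) (≋-refl {r′}) ⟨
      r % n + r′    ≡⟨ m+[n∸m]≡n (m%n≤n r n) ⟩
      n             ≈⟨ n≋0 ⟩
      0             ∎

  ≋⇒≡ : ∀ {m k} → m < n → k < n → m ≋ k → m ≡ k
  ≋⇒≡ m<n k<n (mk≋ p) = trans (sym (m<n⇒m%n≡m m<n)) (trans p (m<n⇒m%n≡m k<n))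

module ZnProperties (a : ℕ) where

  open Congruence (N a)

  toℕ-ι : ∀ k → toℕ (ι a k) ≡ k % N a
  toℕ-ι k = Fin.toℕ-fromℕ< (m%n<n k (N a))

  ι-≋ : ∀ k → toℕ (ι a k) ≋ k
  ι-≋ k = ≋-trans (≡⇒≋ (toℕ-ι k)) (%-≋ k)

  toℕ-≋-injective : ∀ {x y : Zn a} → toℕ x ≋ toℕ y → x ≡ y
  toℕ-≋-injective {x} {y} = Fin.toℕ-injective ∘ ≋⇒≡ (Fin.toℕ<n x) (Fin.toℕ<n y)

  sub-+ : ∀ t s → toℕ (sub a t s) + toℕ s ≋ toℕ t
  sub-+ t s = begin
    toℕ (sub a t s) + toℕ s             ≈⟨ +-cong-≋ (ι-≋ (toℕ t + (N a ∸ toℕ s))) (≋-refl {toℕ s}) ⟩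
    toℕ t + (N a ∸ toℕ s) + toℕ s       ≡⟨ +-assoc (toℕ t) _ _ ⟩
    toℕ t + (N a ∸ toℕ s + toℕ s)       ≡⟨ cong (toℕ t +_) (m∸n+n≡m (<⇒≤ (Fin.toℕ<n s))) ⟩
    toℕ t + N a                         ≈⟨ +-cong-≋ (≋-refl {toℕ t}) n≋0 ⟩
    toℕ t + 0                           ≡⟨ +-identityʳ (toℕ t) ⟩
    toℕ t                               ∎
    where open ≋-Reasoning

  neg-+ : ∀ x → toℕ (neg a x) + toℕ x ≋ 0
  neg-+ x = begin
    toℕ (neg a x) + toℕ x   ≈⟨ +-cong-≋ (ι-≋ (N a ∸ toℕ x)) (≋-refl {toℕ x}) ⟩
    N a ∸ toℕ x + toℕ x     ≡⟨ m∸n+n≡m (<⇒≤ (Fin.toℕ<n x)) ⟩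
    N a                     ≈⟨ n≋0 ⟩
    0                       ∎
    where open ≋-Reasoning

  sub-cancelˡ : ∀ {t t′ s} → sub a t s ≡ sub a t′ s → t ≡ t′
  sub-cancelˡ {t} {t′} {s} eq = toℕ-≋-injective (begin
    toℕ t                     ≈⟨ sub-+ t s ⟨
    toℕ (sub a t s) + toℕ s   ≡⟨ cong (λ w → toℕ w + toℕ s) eq ⟩
    toℕ (sub a t′ s) + toℕ s  ≈⟨ sub-+ t′ s ⟩
    toℕ t′                    ∎)
    where open ≋-Reasoning

  sub-cancelʳ : ∀ {t s s′} → sub a t s ≡ sub a t s′ → s ≡ s′
  sub-cancelʳ {t} {s} {s′} eq = toℕ-≋-injective (+-cancelʳ-≋ (toℕ (sub a t s)) (begin
    toℕ s + toℕ (sub a t s)     ≡⟨ +-comm (toℕ s) _ ⟩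
    toℕ (sub a t s) + toℕ s     ≈⟨ sub-+ t s ⟩
    toℕ t                       ≈⟨ sub-+ t s′ ⟨
    toℕ (sub a t s′) + toℕ s′   ≡⟨ cong (λ w → toℕ w + toℕ s′) eq ⟨
    toℕ (sub a t s) + toℕ s′    ≡⟨ +-comm _ (toℕ s′) ⟩
    toℕ s′ + toℕ (sub a t s)    ∎))
    where open ≋-Reasoning

  sub≡0⇒≡ : ∀ {t s} → sub a t s ≡ zero → t ≡ s
  sub≡0⇒≡ {t} {s} eq = toℕ-≋-injective (begin
    toℕ t                     ≈⟨ sub-+ t s ⟨
    toℕ (sub a t s) + toℕ s   ≡⟨ cong (λ w → toℕ w + toℕ s) eq ⟩
    toℕ s                     ∎)
    where open ≋-Reasoning

  neg-involutive : ∀ x → neg a (neg a x) ≡ x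
  neg-involutive x = toℕ-≋-injective (+-cancelʳ-≋ (toℕ (neg a x)) (begin
    toℕ (neg a (neg a x)) + toℕ (neg a x)   ≈⟨ neg-+ (neg a x) ⟩
    0                                       ≈⟨ neg-+ x ⟨
    toℕ (neg a x) + toℕ x                   ≡⟨ +-comm _ (toℕ x) ⟩
    toℕ x + toℕ (neg a x)                   ∎))
    where open ≋-Reasoning

  neg-zero : neg a zero ≡ zero
  neg-zero = toℕ-≋-injective (≋-trans (≡⇒≋ (sym (+-identityʳ _))) (neg-+ zero))

  neg-sub : ∀ t s → neg a (sub a t s) ≡ sub a (neg a t) (neg a s)
  neg-sub t s = toℕ-≋-injective (+-cancelʳ-≋ (toℕ w) (begin
    toℕ (neg a w) + toℕ w   ≈⟨ neg-+ w ⟩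
    0                       ≈⟨ R+w≋0 ⟨
    toℕ R + toℕ w           ∎))
    where
    open ≋-Reasoning
    w R : Zn a
    w = sub a t s
    R = sub a (neg a t) (neg a s)
    R+w≋0 : toℕ R + toℕ w ≋ 0
    R+w≋0 = begin
      toℕ R + toℕ w                                   ≡⟨ +-identityʳ _ ⟨
      toℕ R + toℕ w + 0                               ≈⟨ +-cong-≋ (≋-refl {toℕ R + toℕ w}) (neg-+ s) ⟨
      toℕ R + toℕ w + (toℕ (neg a s) + toℕ s)         ≡⟨ interchange (toℕ R) (toℕ w) _ _ ⟩
      toℕ R + toℕ (neg a s) + (toℕ w + toℕ s)         ≈⟨ +-cong-≋ (sub-+ (neg a t) (neg a s)) (sub-+ t s) ⟩
      toℕ (neg a t) + toℕ t                           ≈⟨ neg-+ t ⟩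
      0                                               ∎

  toℕ-pos : ∀ {x : Zn a} → x ≢ zero → 0 < toℕ x
  toℕ-pos x≢0 = n≢0⇒n>0 (x≢0 ∘ Fin.toℕ-injective)

  toℕ-neg : ∀ {x} → x ≢ zero → toℕ (neg a x) ≡ N a ∸ toℕ x
  toℕ-neg {x} x≢0 = trans (toℕ-ι (N a ∸ toℕ x))
    (m<n⇒m%n≡m (∸-monoʳ-< (toℕ-pos x≢0) (<⇒≤ (Fin.toℕ<n x))))

  toℕ+toℕ-neg≤N : ∀ x → toℕ x + toℕ (neg a x) ≤ N a
  toℕ+toℕ-neg≤N x = begin
    toℕ x + toℕ (neg a x)           ≡⟨ cong (toℕ x +_) (toℕ-ι (N a ∸ toℕ x)) ⟩
    toℕ x + (N a ∸ toℕ x) % N a     ≤⟨ +-monoʳ-≤ (toℕ x) (m%n≤m _ (N a)) ⟩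
    toℕ x + (N a ∸ toℕ x)           ≡⟨ m+[n∸m]≡n (<⇒≤ (Fin.toℕ<n x)) ⟩
    N a                             ∎
    where open ≤-Reasoning

  neg-fixed⇒toℕ+toℕ≡N : ∀ {x} → x ≢ zero → neg a x ≡ x → toℕ x + toℕ x ≡ N a
  neg-fixed⇒toℕ+toℕ≡N {x} x≢0 fixed = begin
    toℕ x + toℕ x           ≡⟨ cong (λ y → toℕ x + toℕ y) fixed ⟨
    toℕ x + toℕ (neg a x)   ≡⟨ cong (toℕ x +_) (toℕ-neg x≢0) ⟩
    toℕ x + (N a ∸ toℕ x)   ≡⟨ m+[n∸m]≡n (<⇒≤ (Fin.toℕ<n x)) ⟩
    N a                     ∎
    where open ≡-Reasoning

  neg-fixed-unique : ∀ {x y} → x ≢ zero → neg a x ≡ x → y ≢ zero → neg a y ≡ y → x ≡ y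
  neg-fixed-unique {x} {y} x≢0 x-fixed y≢0 y-fixed = Fin.toℕ-injective (begin
    toℕ x                   ≡⟨ n≡⌊n+n/2⌋ (toℕ x) ⟩
    ⌊ toℕ x + toℕ x /2⌋     ≡⟨ cong ⌊_/2⌋ (neg-fixed⇒toℕ+toℕ≡N x≢0 x-fixed) ⟩
    ⌊ N a /2⌋               ≡⟨ cong ⌊_/2⌋ (neg-fixed⇒toℕ+toℕ≡N y≢0 y-fixed) ⟨
    ⌊ toℕ y + toℕ y /2⌋     ≡⟨ n≡⌊n+n/2⌋ (toℕ y) ⟨
    toℕ y                   ∎)
    where open ≡-Reasoning

-- The sets P_x

module Pairs (a : ℕ) where

  open ZnProperties a

  data InP (x : Zn a) : Zn a → Set where
    same     : InP x x
    opposite : InP x (neg a x)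

  InP-neg : ∀ {x z} → InP x z → InP x (neg a z)
  InP-neg same = opposite
  InP-neg {x} opposite = subst (InP x) (sym (neg-involutive x)) same

  InP-sym : ∀ {x z} → InP x z → InP z x
  InP-sym same = same
  InP-sym {x} opposite = subst (InP (neg a x)) (neg-involutive x) opposite

  InP-trans : ∀ {x y z} → InP y z → InP x y → InP x z
  InP-trans same x∼y = x∼y
  InP-trans opposite x∼y = InP-neg x∼y

  ‖_‖ : Zn a → ℕ
  ‖ x ‖ = toℕ x ⊓ toℕ (neg a x)

  ‖neg‖ : ∀ x → ‖ neg a x ‖ ≡ ‖ x ‖
  ‖neg‖ x = trans (cong (λ y → toℕ (neg a x) ⊓ toℕ y) (neg-involutive x)) (⊓-comm _ _)

  InP⇒‖‖≡ : ∀ {x z} → InP x z → ‖ z ‖ ≡ ‖ x ‖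
  InP⇒‖‖≡ same = refl
  InP⇒‖‖≡ {x} opposite = ‖neg‖ x

  Canonical : Zn a → Set
  Canonical x = toℕ x ≤ toℕ (neg a x)

  canonical-exists : ∀ z → ∃ λ x → Canonical x × InP x z
  canonical-exists z with ≤-total (toℕ z) (toℕ (neg a z))
  ... | inj₁ z≤-z = z , z≤-z , same
  ... | inj₂ -z≤z = neg a z , subst (λ y → toℕ (neg a z) ≤ toℕ y) (sym (neg-involutive z)) -z≤z
                            , InP-sym opposite

  canonical-unique : ∀ {x y z} → Canonical x → Canonical y → InP x z → InP y z → x ≡ y
  canonical-unique {x} {y} {z} x-can y-can x∼z y∼z = Fin.toℕ-injective (begin
    toℕ x   ≡⟨ m≤n⇒m⊓n≡m x-can ⟨
    ‖ x ‖   ≡⟨ InP⇒‖‖≡ x∼z ⟨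
    ‖ z ‖   ≡⟨ InP⇒‖‖≡ y∼z ⟩
    ‖ y ‖   ≡⟨ m≤n⇒m⊓n≡m y-can ⟩
    toℕ y   ∎)
    where open ≡-Reasoning

  h-bounds : h a + h a ≤ N a × N a ≤ suc (h a + h a)
  h-bounds = bounds (2 ∣? a)
    where
    q*2≡q+q : ∀ q → q * 2 ≡ q + q
    q*2≡q+q q = trans (*-comm q 2) (cong (q +_) (+-identityʳ q))
    half-bounds : ∀ m → m / 2 + m / 2 ≤ m × m ≤ suc (m / 2 + m / 2)
    half-bounds m = subst (m / 2 + m / 2 ≤_) (sym m≡r+2q) (m≤n+m _ (m % 2))
                  , subst (_≤ suc (m / 2 + m / 2)) (sym m≡r+2q) (+-monoˡ-≤ _ (<⇒≤pred (m%n<n m 2)))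
      where
      m≡r+2q : m ≡ m % 2 + (m / 2 + m / 2)
      m≡r+2q = trans (m≡m%n+[m/n]*n m 2) (cong (m % 2 +_) (q*2≡q+q (m / 2)))
    bounds : (even? : Dec (2 ∣ a)) →
             let k = if does even? then a * a / 2 else (a * a + 1) / 2 in k + k ≤ N a × N a ≤ suc (k + k)
    bounds (yes 2∣a) = ≤-trans (≤-reflexive (sym a*a≡k+k)) (n≤1+n _) , ≤-reflexive (cong suc a*a≡k+k)
      where
      a*a≡k+k : a * a ≡ a * a / 2 + a * a / 2
      a*a≡k+k = trans (sym (m/n*n≡m (∣m⇒∣m*n a 2∣a))) (q*2≡q+q (a * a / 2))
    bounds (no _) = subst (λ m → k + k ≤ m × m ≤ suc (k + k)) (+-comm (a * a) 1) (half-bounds (a * a + 1))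
      where k = (a * a + 1) / 2

  rep+rep≤N : ∀ i → suc (toℕ i) + suc (toℕ i) ≤ N a
  rep+rep≤N i = ≤-trans (+-mono-≤ {suc (toℕ i)} {h a} (Fin.toℕ<n i) (Fin.toℕ<n i)) (proj₁ h-bounds)

  toℕ-rep : ∀ i → toℕ (rep a i) ≡ suc (toℕ i)
  toℕ-rep i = trans (toℕ-ι (suc (toℕ i))) (m<n⇒m%n≡m (<-≤-trans (m<m+n (suc (toℕ i)) z<s) (rep+rep≤N i)))

  rep≢0 : ∀ i → rep a i ≢ zero
  rep≢0 i rep≡0 = 0≢1+n (trans (sym (cong toℕ rep≡0)) (toℕ-rep i))

  ‖rep‖ : ∀ i → ‖ rep a i ‖ ≡ suc (toℕ i)
  ‖rep‖ i = trans (m≤n⇒m⊓n≡m rep≤-rep) (toℕ-rep i)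
    where
    rep≤-rep : toℕ (rep a i) ≤ toℕ (neg a (rep a i))
    rep≤-rep = subst₂ _≤_ (sym (toℕ-rep i)) (sym (trans (toℕ-neg (rep≢0 i)) (cong (N a ∸_) (toℕ-rep i))))
                 (m+n≤o⇒m≤o∸n _ (rep+rep≤N i))

  InP-rep-injective : ∀ {i j z} → InP (rep a i) z → InP (rep a j) z → i ≡ j
  InP-rep-injective {i} {j} {z} i∼z j∼z = Fin.toℕ-injective (suc-injective (begin
    suc (toℕ i)      ≡⟨ ‖rep‖ i ⟨
    ‖ rep a i ‖      ≡⟨ InP⇒‖‖≡ i∼z ⟨
    ‖ z ‖            ≡⟨ InP⇒‖‖≡ j∼z ⟩
    ‖ rep a j ‖      ≡⟨ ‖rep‖ j ⟩
    suc (toℕ j)      ∎))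
    where open ≡-Reasoning

  ‖‖≤h : ∀ x → ‖ x ‖ ≤ h a
  ‖‖≤h x = m+m≤1+k+k⇒m≤k (begin
    ‖ x ‖ + ‖ x ‖               ≤⟨ +-mono-≤ (m⊓n≤m (toℕ x) (toℕ (neg a x))) (m⊓n≤n (toℕ x) (toℕ (neg a x))) ⟩
    toℕ x + toℕ (neg a x)       ≤⟨ toℕ+toℕ-neg≤N x ⟩
    N a                         ≤⟨ proj₂ h-bounds ⟩
    suc (h a + h a)             ∎)
    where
    open ≤-Reasoning
    m+m≤1+k+k⇒m≤k : ∀ {m k} → m + m ≤ suc (k + k) → m ≤ k
    m+m≤1+k+k⇒m≤k {m} {k} le = ≮⇒≥ λ k<m →
      1+n≰n (≤-trans (≤-reflexive (cong suc (sym (+-suc k k)))) (≤-trans (+-mono-≤ k<m k<m) le))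

  rep-onto : ∀ x → x ≢ zero → toℕ x ≤ h a → ∃ λ i → rep a i ≡ x
  rep-onto x x≢0 x≤h with toℕ x in eq | toℕ-pos x≢0
  ... | suc k | _ = fromℕ< x≤h ,
    Fin.toℕ-injective (trans (toℕ-rep _) (trans (cong suc (Fin.toℕ-fromℕ< x≤h)) (sym eq)))

  InP-zero : ∀ {z} → InP zero z → z ≡ zero
  InP-zero same = refl
  InP-zero opposite = neg-zero

  rep-covers : ∀ {z} → z ≢ zero → ∃ λ i → InP (rep a i) z
  rep-covers {z} z≢0 with canonical-exists z
  ... | x , x-can , x∼z with rep-onto x x≢0 (subst (_≤ h a) (m≤n⇒m⊓n≡m x-can) (‖‖≤h x))
    where
    x≢0 : x ≢ zero
    x≢0 refl = z≢0 (InP-zero x∼z)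
  ... | i , refl = i , x∼z

-- Differences

module Differences (a : ℕ) where

  open ZnProperties a
  open Pairs a

  T-inP : ∀ {x z} → T (inP a x z) ⇔ InP x z
  T-inP {x} {z} =
    mk⇔ (λ { (inj₁ refl) → same ; (inj₂ refl) → opposite }) (λ { same → inj₁ refl ; opposite → inj₂ refl })
    ⇔-∘ T-∨⇔ (T-eqF {x = z} {x}) (T-eqF {x = z} {neg a x})

  InD : Zn a → Zn a → Zn a → Set
  InD v y x = ∃₂ λ t s → InP y t × InP x s × sub a t s ≡ v

  T-inD : ∀ {v y x} → T (inD a v y x) ⇔ InD v y x
  T-inD {v} {y} {x} = mk⇔ (cases ∘ Equivalence.to expand) (Equivalence.from expand ∘ uncases)
    where
    FourCases : Set
    FourCases = sub a y x ≡ v ⊎ sub a y (neg a x) ≡ v ⊎ sub a (neg a y) x ≡ v ⊎ sub a (neg a y) (neg a x) ≡ v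
    expand : T (inD a v y x) ⇔ FourCases
    expand = T-∨⇔ T-eqF (T-∨⇔ T-eqF (T-∨⇔ T-eqF T-eqF))
    cases : FourCases → InD v y x
    cases (inj₁ e) = y , x , same , same , e
    cases (inj₂ (inj₁ e)) = y , neg a x , same , opposite , e
    cases (inj₂ (inj₂ (inj₁ e))) = neg a y , x , opposite , same , e
    cases (inj₂ (inj₂ (inj₂ e))) = neg a y , neg a x , opposite , opposite , e
    uncases : InD v y x → FourCases
    uncases (_ , _ , same , same , e) = inj₁ e
    uncases (_ , _ , same , opposite , e) = inj₂ (inj₁ e)
    uncases (_ , _ , opposite , same , e) = inj₂ (inj₂ (inj₁ e))
    uncases (_ , _ , opposite , opposite , e) = inj₂ (inj₂ (inj₂ e))

  InD-neg : ∀ {v y x} → InD v y x → InD (neg a v) y x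
  InD-neg (t , s , y∼t , x∼s , e) =
    neg a t , neg a s , InP-neg y∼t , InP-neg x∼s , trans (sym (neg-sub t s)) (cong (neg a) e)

  InD-resp-InP : ∀ {v w y x} → InP v w → InD v y x → InD w y x
  InD-resp-InP same d = d
  InD-resp-InP opposite d = InD-neg d

  InP-sub-unique : ∀ {z t s t′ s′} → neg a z ≢ z → InP t t′ → InP s s′ →
                   sub a t s ≡ z → sub a t′ s′ ≡ z → t ≡ t′ × s ≡ s′
  InP-sub-unique {t = t} _ same _ t-s≡z t-s′≡z = refl , sub-cancelʳ {t} (trans t-s≡z (sym t-s′≡z))
  InP-sub-unique {s = s} _ opposite same t-s≡z t′-s≡z = sub-cancelˡ {s = s} (trans t-s≡z (sym t′-s≡z)) , refl
  InP-sub-unique {z} {t} {s} z-nonfixed opposite opposite t-s≡z t′-s′≡z = contradiction (begin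
    neg a z                       ≡⟨ cong (neg a) t-s≡z ⟨
    neg a (sub a t s)             ≡⟨ neg-sub t s ⟩
    sub a (neg a t) (neg a s)     ≡⟨ t′-s′≡z ⟩
    z                             ∎) z-nonfixed
    where open ≡-Reasoning

  T-PsubD : ∀ {d y x} → T (PsubD a d y x) ⇔ InD d y x
  T-PsubD = mk⇔ (Equivalence.to T-inD ∘ proj₁ ∘ Equivalence.to T-∧)
    (λ d → Equivalence.from T-∧ (Equivalence.from T-inD d , Equivalence.from T-inD (InD-neg d)))

  Dentry : Subset (N a) → Subset (N a) → Zn a → Zn a → Zn a → Bool
  Dentry X Y z t s = Vec.lookup X t ∧ Vec.lookup Y s ∧ eqF (sub a t s) z

  Dmult≡count₂ : ∀ X Y z → Dmult a X Y z ≡ count₂ (Dentry X Y z)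
  Dmult≡count₂ X Y z = trans (sum-tabulate (λ t → count (N a) (Dentry X Y z t)))
    (sum-cong-≗ λ t → count≡sum (N a) (Dentry X Y z t))

  Dmult≤∣∣ : ∀ X Y z → Dmult a X Y z ≤ ∣ Y ∣
  Dmult≤∣∣ X Y z = begin
    Dmult a X Y z                                 ≡⟨ Dmult≡count₂ X Y z ⟩
    sum (λ t → sum λ s → b2n (Dentry X Y z t s))  ≤⟨ sum-mono-≤ (λ t → sum-mono-≤ (drop-X t)) ⟩
    sum (λ t → sum λ s → b2n (Y-hit t s))         ≡⟨ ∑-comm (λ t s → b2n (Y-hit t s)) ⟩
    sum (λ s → sum λ t → b2n (Y-hit t s))         ≤⟨ sum-mono-≤ column≤ ⟩
    sum (b2n ∘ Vec.lookup Y)                      ≡⟨ ∣∣≡sum Y ⟨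
    ∣ Y ∣                                         ∎
    where
    open ≤-Reasoning
    Y-hit : Zn a → Zn a → Bool
    Y-hit t s = Vec.lookup Y s ∧ eqF (sub a t s) z
    drop-X : ∀ t s → b2n (Dentry X Y z t s) ≤ b2n (Y-hit t s)
    drop-X t s with Vec.lookup X t
    ... | true = ≤-refl
    ... | false = z≤n
    column≤ : ∀ s → sum (λ t → b2n (Y-hit t s)) ≤ b2n (Vec.lookup Y s)
    column≤ s = begin
      sum (λ t → b2n (Y-hit t s))                ≡⟨ sum-b2n-∧ (Vec.lookup Y s) (λ t → eqF (sub a t s) z) ⟩
      b2n (Vec.lookup Y s) * sum (b2n ∘ hit)     ≤⟨ *-monoʳ-≤ (b2n (Vec.lookup Y s)) at-most-one ⟩
      b2n (Vec.lookup Y s) * 1                   ≡⟨ *-identityʳ (b2n (Vec.lookup Y s)) ⟩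
      b2n (Vec.lookup Y s)                       ∎
      where
      hit : Zn a → Bool
      hit t = eqF (sub a t s) z
      at-most-one : sum (b2n ∘ hit) ≤ 1
      at-most-one = unique⇒sum-b2n≤1 hit λ p q →
        sub-cancelˡ {s = s} (trans (Equivalence.to T-eqF p) (sym (Equivalence.to T-eqF q)))

  sum-Dmult : ∀ X Y → sum (Dmult a X Y) ≡ ∣ X ∣ * ∣ Y ∣
  sum-Dmult X Y = begin
    sum (Dmult a X Y)                         ≡⟨ sum-cong-≗ (Dmult≡count₂ X Y) ⟩
    sum (λ z → sum λ t → sum (D z t))         ≡⟨ ∑-comm (λ z t → sum (D z t)) ⟩
    sum (λ t → sum λ z → sum (D z t))         ≡⟨ sum-cong-≗ (λ t → ∑-comm (λ z → D z t)) ⟩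
    sum (λ t → sum λ s → sum λ z → D z t s)   ≡⟨ sum-cong-≗ (λ t → sum-cong-≗ (entry t)) ⟩
    sum (λ t → sum λ s → χ X t * χ Y s)       ≡⟨ sum-cong-≗ (λ t → *-distribˡ-sum (χ X t) (χ Y)) ⟨
    sum (λ t → χ X t * sum (χ Y))             ≡⟨ *-distribʳ-sum (sum (χ Y)) (χ X) ⟨
    sum (χ X) * sum (χ Y)                     ≡⟨ cong₂ _*_ (∣∣≡sum X) (∣∣≡sum Y) ⟨
    ∣ X ∣ * ∣ Y ∣                             ∎
    where
    open ≡-Reasoning
    D : Zn a → Zn a → Zn a → ℕ
    D z t s = b2n (Dentry X Y z t s)
    χ : Subset (N a) → Zn a → ℕ
    χ P t = b2n (Vec.lookup P t)
    entry : ∀ t s → sum (λ z → D z t s) ≡ χ X t * χ Y s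
    entry t s = begin
      sum (λ z → D z t s)                            ≡⟨ sum-b2n-∧ (Vec.lookup X t) (λ z → Vec.lookup Y s ∧ eqF w z) ⟩
      χ X t * sum (λ z → b2n (Vec.lookup Y s ∧ eqF w z)) ≡⟨ cong (χ X t *_) (sum-b2n-∧ (Vec.lookup Y s) (eqF w)) ⟩
      χ X t * (χ Y s * sum (λ z → b2n (eqF w z)))    ≡⟨ cong (λ m → χ X t * (χ Y s * m)) (sum-b2n-eqF w) ⟩
      χ X t * (χ Y s * 1)                            ≡⟨ cong (χ X t *_) (*-identityʳ (χ Y s)) ⟩
      χ X t * χ Y s                                  ∎
      where
      w : Zn a
      w = sub a t s

-- Mates

n*m+1≡m*m+k⇒k≡1 : ∀ {m n k} → n * m + 1 ≡ m * m + k → 0 < k → k ≤ m → k ≡ 1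
n*m+1≡m*m+k⇒k≡1 {m} {n} {k} eq 0<k k≤m with n ≤? m
... | yes n≤m = ≤-antisym (+-cancelˡ-≤ (m * m) k 1 (begin
  m * m + k      ≡⟨ eq ⟨
  n * m + 1      ≤⟨ +-monoˡ-≤ 1 (*-monoˡ-≤ m n≤m) ⟩
  m * m + 1      ∎)) 0<k
  where open ≤-Reasoning
... | no n≰m = contradiction (+-cancelˡ-≤ (m * m) (suc m) k (begin
  m * m + suc m  ≡⟨ square-step m ⟩
  suc m * m + 1  ≤⟨ +-monoˡ-≤ 1 (*-monoˡ-≤ m (≰⇒> n≰m)) ⟩
  n * m + 1      ≡⟨ eq ⟩
  m * m + k      ∎)) (<⇒≱ (s≤s k≤m))
  where
  open ≤-Reasoning
  square-step : ∀ m → m * m + suc m ≡ suc m * m + 1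
  square-step = solve-∀

target : (a : ℕ) → Zn a → ℕ
target a z = if eqF z (zero {n = a * a}) then 0 else 1

target≡1 : ∀ {a} {z : Zn a} → z ≢ zero → target a z ≡ 1
target≡1 {z = zero} z≢0 = contradiction refl z≢0
target≡1 {z = suc _} _ = refl

sum-target : ∀ a → sum (target a) ≡ a * a
sum-target a = sum-ones (a * a)

module Mate (a : ℕ) (A : Subset (N a))
            (A-symmetric : ∀ {x} → x ∈ᵇ A → neg a x ∈ᵇ A)
            (U : Vec01 a A) where

  open ZnProperties a
  open Pairs a
  open Differences a

  B : Subset (N a)
  B = Bset a A U

  chosen : Fin (h a) → Bool
  chosen i = restrictB (not (subP a A (rep a i))) (λ p → U (i , p))

  chosen⇒⊈ : ∀ {i} → T (chosen i) → ¬ T (subP a A (rep a i))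
  chosen⇒⊈ {i} c = subst T (Equivalence.to T-not-≡ (T-restrictB (λ p → U (i , p)) c))

  ∈A⇒⊆A : ∀ {x s} → s ∈ᵇ A → InP x s → T (subP a A x)
  ∈A⇒⊆A s∈A x∼s with InP-sym x∼s
  ... | same = Equivalence.from T-∧ (s∈A , A-symmetric s∈A)
  ... | opposite = Equivalence.from T-∧ (A-symmetric s∈A , subst (_∈ᵇ A) (sym (neg-involutive _)) s∈A)

  ⊆A⇒∈A : ∀ {x s} → T (subP a A x) → InP x s → s ∈ᵇ A
  ⊆A⇒∈A x⊆A same = proj₁ (Equivalence.to T-∧ x⊆A)
  ⊆A⇒∈A x⊆A opposite = proj₂ (Equivalence.to T-∧ x⊆A)

  ∈B⇔ : ∀ t → t ∈ᵇ B ⇔ ∃ λ i → T (chosen i) × InP (rep a i) t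
  ∈B⇔ t = mk⇔
    (λ t∈B → let i , p = Equivalence.to (T-or-tabulate (member t)) (subst T (lookup-B t) t∈B)
                 c , q = Equivalence.to (T-restrictB-∧ (λ p → U (i , p)) (inP a (rep a i) t)) p
             in i , c , Equivalence.to T-inP q)
    (λ (i , c , i∼t) → subst T (sym (lookup-B t)) (Equivalence.from (T-or-tabulate (member t))
      (i , Equivalence.from (T-restrictB-∧ (λ p → U (i , p)) (inP a (rep a i) t)) (c , Equivalence.from T-inP i∼t))))
    where
    member : Zn a → Fin (h a) → Bool
    member z i = restrictB (not (subP a A (rep a i))) (λ p → U (i , p) ∧ inP a (rep a i) z)
    lookup-B : ∀ t → Vec.lookup B t ≡ or (List.tabulate (member t))
    lookup-B = Vec.lookup∘tabulate (or ∘ List.tabulate ∘ member)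

  Mentry : Fin (h a) → Fin (h a) → Zn a → Bool
  Mentry d i x = (toℕ x ≤ᵇ toℕ (neg a x)) ∧ subP a A x ∧ PsubD a (rep a d) (rep a i) x

  MUentry : Fin (h a) → Fin (h a) → Zn a → Bool
  MUentry d i x = chosen i ∧ Mentry d i x

  MU≡count₂ : ∀ d → MU a A U d ≡ count₂ (MUentry d)
  MU≡count₂ d = trans (sum-tabulate λ i → restrictℕ (not (subP a A (rep a i))) λ p → M a A d i * b2n (U (i , p)))
    (sum-cong-≗ λ i → restrictℕ-count (not (subP a A (rep a i))) (λ p → U (i , p)) (Mentry d i))

  -- The pairs (P_y, P_x) counted by (M_A U^T)[P_d], with y = rep a i.
  record MUWitness (d i : Fin (h a)) (x : Zn a) : Set where
    constructor mu-witness
    field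
      is-chosen : T (chosen i)
      canonical : Canonical x
      x⊆A       : T (subP a A x)
      d∈D       : InD (rep a d) (rep a i) x

  T-MUentry : ∀ d i x → T (MUentry d i x) ⇔ MUWitness d i x
  T-MUentry d i x =
    mk⇔ (λ (c , x-can , x⊆A , d∈D) → mu-witness c x-can x⊆A d∈D)
        (λ (mu-witness c x-can x⊆A d∈D) → c , x-can , x⊆A , d∈D)
    ⇔-∘ T-∧⇔ (⇔-id _) (T-∧⇔ T-≤ᵇ (T-∧⇔ (⇔-id _) T-PsubD))

  record DWitness (z t s : Zn a) : Set where
    constructor d-witness
    field
      t∈B   : t ∈ᵇ B
      s∈A   : s ∈ᵇ A
      t-s≡z : sub a t s ≡ z

  T-Dentry : ∀ z t s → T (Dentry B A z t s) ⇔ DWitness z t s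
  T-Dentry z t s =
    mk⇔ (λ (t∈B , s∈A , t-s≡z) → d-witness t∈B s∈A t-s≡z)
        (λ (d-witness t∈B s∈A t-s≡z) → t∈B , s∈A , t-s≡z)
    ⇔-∘ T-∧⇔ (⇔-id _) (T-∧⇔ (⇔-id _) T-eqF)

  D⇒MU : ∀ d {z t s} → InP (rep a d) z → DWitness z t s →
         ∃₂ λ i x → MUWitness d i x × InP (rep a i) t × InP x s
  D⇒MU d {t = t} {s} d∼z (d-witness t∈B s∈A t-s≡z) with Equivalence.to (∈B⇔ t) t∈B | canonical-exists s
  ... | i , c , i∼t | x , x-can , x∼s =
    i , x , mu-witness c x-can (∈A⇒⊆A s∈A x∼s) (InD-resp-InP (InP-sym d∼z) (t , s , i∼t , x∼s , t-s≡z))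
    , i∼t , x∼s

  MU⇒D : ∀ d {z i x} → InP (rep a d) z → MUWitness d i x →
         ∃₂ λ t s → DWitness z t s × InP (rep a i) t × InP x s
  MU⇒D d {i = i} d∼z (mu-witness c _ x⊆A d∈D) with InD-resp-InP d∼z d∈D
  ... | t , s , i∼t , x∼s , t-s≡z =
    t , s , d-witness (Equivalence.from (∈B⇔ t) (i , c , i∼t)) (⊆A⇒∈A x⊆A x∼s) t-s≡z , i∼t , x∼s

  mult : Zn a → ℕ
  mult = Dmult a B A

  mult≡count₂ : ∀ z → mult z ≡ count₂ (Dentry B A z)
  mult≡count₂ = Dmult≡count₂ B A

  mate⇒solves : IsMate a A B → SolvesMatEq a A U
  mate⇒solves (_ , mult≡target) d = trans (MU≡count₂ d) (≤-antisym MU≤1 MU-pos)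
    where
    Dd≡1 : count₂ (Dentry B A (rep a d)) ≡ 1
    Dd≡1 = trans (sym (mult≡count₂ (rep a d))) (trans (mult≡target (rep a d)) (target≡1 {a} (rep≢0 d)))
    MU-pos : 0 < count₂ (MUentry d)
    MU-pos =
      let _ , _ , v = Equivalence.to (count₂-pos⇔ (T-Dentry (rep a d))) (≤-reflexive (sym Dd≡1))
          i , x , w , _ = D⇒MU d same v
      in Equivalence.from (count₂-pos⇔ (T-MUentry d)) (i , x , w)
    MU-unique : ∀ {i x i′ x′} → MUWitness d i x → MUWitness d i′ x′ → i ≡ i′ × x ≡ x′
    MU-unique w w′ =
      let _ , _ , v , i∼t , x∼s = MU⇒D d same w
          _ , _ , v′ , i′∼t′ , x′∼s′ = MU⇒D d same w′
          t≡t′ , s≡s′ = Equivalence.to (count₂≤1⇔ (T-Dentry (rep a d))) (≤-reflexive Dd≡1) v v′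
      in InP-rep-injective i∼t (subst (InP _) (sym t≡t′) i′∼t′)
       , canonical-unique (MUWitness.canonical w) (MUWitness.canonical w′)
                          x∼s (subst (InP _) (sym s≡s′) x′∼s′)
    MU≤1 : count₂ (MUentry d) ≤ 1
    MU≤1 = Equivalence.from (count₂≤1⇔ (T-MUentry d)) MU-unique

  module _ (0<a : 0 < a) (∣A∣≡a : ∣ A ∣ ≡ a) (solves : SolvesMatEq a A U) where

    MU≡1 : ∀ d → count₂ (MUentry d) ≡ 1
    MU≡1 d = trans (sym (MU≡count₂ d)) (solves d)

    MU-exists : ∀ d → ∃₂ (MUWitness d)
    MU-exists d = Equivalence.to (count₂-pos⇔ (T-MUentry d)) (≤-reflexive (sym (MU≡1 d)))

    MU-unique : ∀ {d i x i′ x′} → MUWitness d i x → MUWitness d i′ x′ → i ≡ i′ × x ≡ x′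
    MU-unique {d} = Equivalence.to (count₂≤1⇔ (T-MUentry d)) (≤-reflexive (MU≡1 d))

    mult-zero : mult zero ≡ 0
    mult-zero = trans (mult≡count₂ zero)
      (n≤0⇒n≡0 (≮⇒≥ λ pos → no-witness (Equivalence.to (count₂-pos⇔ (T-Dentry zero)) pos)))
      where
      no-witness : ¬ ∃₂ (DWitness zero)
      no-witness (t , s , d-witness t∈B s∈A t-s≡0) =
        let i , c , i∼t = Equivalence.to (∈B⇔ t) t∈B
        in chosen⇒⊈ c (∈A⇒⊆A (subst (_∈ᵇ A) (sym (sub≡0⇒≡ t-s≡0)) s∈A) i∼t)

    mult-pos : ∀ {z} → z ≢ zero → 0 < mult z
    mult-pos {z} z≢0 =
      let d , d∼z = rep-covers z≢0
          _ , _ , w = MU-exists d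
          t , s , v , _ = MU⇒D d d∼z w
      in subst (0 <_) (sym (mult≡count₂ z)) (Equivalence.from (count₂-pos⇔ (T-Dentry z)) (t , s , v))

    mult≤1 : ∀ {z} → z ≢ zero → neg a z ≢ z → mult z ≤ 1
    mult≤1 {z} z≢0 z-nonfixed =
      subst (_≤ 1) (sym (mult≡count₂ z)) (Equivalence.from (count₂≤1⇔ (T-Dentry z)) D-unique)
      where
      D-unique : ∀ {t s t′ s′} → DWitness z t s → DWitness z t′ s′ → t ≡ t′ × s ≡ s′
      D-unique {t′ = t′} {s′ = s′} v v′ =
        let d , d∼z = rep-covers z≢0
            _ , _ , w , i∼t , x∼s = D⇒MU d d∼z v
            _ , _ , w′ , i′∼t′ , x′∼s′ = D⇒MU d d∼z v′
            i≡i′ , x≡x′ = MU-unique w w′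
        in InP-sub-unique z-nonfixed
             (InP-trans (subst (λ i → InP (rep a i) t′) (sym i≡i′) i′∼t′) (InP-sym i∼t))
             (InP-trans (subst (λ x → InP x s′) (sym x≡x′) x′∼s′) (InP-sym x∼s))
             (DWitness.t-s≡z v) (DWitness.t-s≡z v′)

    mult≤a : ∀ z → mult z ≤ a
    mult≤a z = subst (mult z ≤_) ∣A∣≡a (Dmult≤∣∣ B A z)

    mult-nonfixed : ∀ {z} → z ≢ zero → neg a z ≢ z → mult z ≡ 1
    mult-nonfixed z≢0 z-nonfixed = ≤-antisym (mult≤1 z≢0 z-nonfixed) (mult-pos z≢0)

    mult-fixed : ∀ {w} → w ≢ zero → neg a w ≡ w → mult w ≡ 1
    mult-fixed {w} w≢0 w-fixed = n*m+1≡m*m+k⇒k≡1 {a} {∣ B ∣} counted (mult-pos w≢0) (mult≤a w)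
      where
      elsewhere : ∀ z → z ≢ w → mult z ≡ target a z
      elsewhere z z≢w with z Fin.≟ zero
      ... | yes refl = mult-zero
      ... | no z≢0 = trans (mult-nonfixed z≢0 λ z-fixed → z≢w (neg-fixed-unique z≢0 z-fixed w≢0 w-fixed))
                           (sym (target≡1 {a} z≢0))
      counted : ∣ B ∣ * a + 1 ≡ a * a + mult w
      counted = begin
        ∣ B ∣ * a + 1             ≡⟨ cong₂ _+_ (trans (sum-Dmult B A) (cong (∣ B ∣ *_) ∣A∣≡a)) (target≡1 {a} w≢0) ⟨
        sum mult + target a w     ≡⟨ sum-agree-except mult (target a) w elsewhere ⟩
        sum (target a) + mult w   ≡⟨ cong (_+ mult w) (sum-target a) ⟩
        a * a + mult w            ∎
        where open ≡-Reasoning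

    mult≡target : ∀ z → mult z ≡ target a z
    mult≡target z with z Fin.≟ zero
    ... | yes refl = mult-zero
    ... | no z≢0 with neg a z Fin.≟ z
    ... | no z-nonfixed = trans (mult-nonfixed z≢0 z-nonfixed) (sym (target≡1 {a} z≢0))
    ... | yes z-fixed = trans (mult-fixed z≢0 z-fixed) (sym (target≡1 {a} z≢0))

    solves⇒mate : IsMate a A B
    solves⇒mate = *-cancelʳ-≡ ∣ B ∣ a a {{>-nonZero 0<a}} ∣B∣*a≡a*a , mult≡target
      where
      ∣B∣*a≡a*a : ∣ B ∣ * a ≡ a * a
      ∣B∣*a≡a*a = trans (trans (sym (cong (∣ B ∣ *_) ∣A∣≡a)) (sym (sum-Dmult B A)))
                        (trans (sum-cong-≗ mult≡target) (sum-target a))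

theorem3p14 : (a : ℕ) → 0 < a → (A : Subset (N a)) →
    ∣ A ∣ ≡ a →
    (∀ x → x ∈ A → neg a x ∈ A) →
    (∀ x → x ∈ A → Σ (Zn a) (λ y → T (inP a y x) × T (subP a A y))) →
    (2 ∣ a → zero ∉ A) →
    (¬ (2 ∣ a) → zero ∈ A × ι a ((a * a + 1) / 2) ∉ A) →
    (U : Vec01 a A) →
    SolvesMatEq a A U ⇔ IsMate a A (Bset a A U)
theorem3p14 a 0<a A ∣A∣≡a A-symmetric _ _ _ U = mk⇔ (solves⇒mate 0<a ∣A∣≡a) mate⇒solves
  where
  open Mate a A (λ {x} → Equivalence.from ∈ᵇ⇔∈ ∘ A-symmetric x ∘ Equivalence.to ∈ᵇ⇔∈) U
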